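{- Let $\Sigma$ be a finite alphabet, and let $A = a_1 \ldots a_n$ and $B = b_1 \ldots b_m$ be strings over $\Sigma$ with $n \ge m$. For each cell $d_{ij}$, let $v(i,j)$ denote the minimum cost of a path from $d_{00}$ to $d_{ij}$ in the modified edit graph. Then: - along each row, among cells on diagonals $\le n-m$ (left of the main diagonal), the values $v(i,j)$ are monotonically decreasing (non-increasing) as $j$ increases; - along each column, among cells on diagonals $\ge n-m$ (right of the main diagonal), the values $v(i,j)$ are monotonically decreasing (non-increasing) as $i$ increases.
   Context: The cells are $d_{ij}$ for $0 \le i \le m$ and $0 \le j \le n$. Cell $d_{ij}$ lies on diagonal $j-i$, and diagonal $n-m$ is the main diagonal. The transitions are the following. - Horizontal: $d_{ij} \to d_{i,j+1}$. - Vertical: $d_{ij} \to d_{i+1,j}$. - Diagonal: $d_{ij} \to d_{i+1,j+1}$. In the modified edit graph the costs are assigned as follows. - A diagonal transition costs $0$ if $a_{j+1} = b_{i+1}$ and $1$ otherwise. - Left of the main diagonal (cells on diagonals $\le n-m$), vertical transitions cost $2$ and horizontal transitions cost $0$. - Right of the main diagonal (cells on diagonals $\ge n-m$), horizontal transitions cost $2$ and vertical transitions cost $0$. That is, an indel moving away from the main diagonal costs $2$, and one moving toward it costs $0$. -}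

module Defs where

open import Data.Nat using (ℕ; zero; suc; _+_; _≤_; _<_; _<ᵇ_)
open import Data.Fin using (Fin; fromℕ<)
open import Data.Fin.Properties using () renaming (_≟_ to _≟ᶠ_)
open import Data.Vec using (Vec; lookup)
open import Data.Bool using (if_then_else_)
open import Data.Product using (_×_)
open import Relation.Nullary using (does)

-- Cell d_ij is represented by the pair of naturals (i , j), 0 ≤ i ≤ m, 0 ≤ j ≤ n.
-- Cell d_ij lies on diagonal j - i; the main diagonal is n - m.
module EditGraph {k n m : ℕ} (A : Vec (Fin k) n) (B : Vec (Fin k) m) where

  -- Cost of the horizontal transition d_ij → d_i(j+1):
  -- 0 if it moves toward the main diagonal, i.e. d_ij strictly left of it
  -- (j - i < n - m, i.e. j + m < n + i); 2 otherwise (moving away).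
  hcost : ℕ → ℕ → ℕ
  hcost i j = if (j + m) <ᵇ (n + i) then 0 else 2

  -- Cost of the vertical transition d_ij → d_(i+1)j:
  -- 0 if d_ij strictly right of the main diagonal (j - i > n - m,
  -- i.e. n + i < j + m); 2 otherwise (moving away).
  vcost : ℕ → ℕ → ℕ
  vcost i j = if (n + i) <ᵇ (j + m) then 0 else 2

  -- Cost of the diagonal transition d_ij → d_(i+1)(j+1):
  -- 0 if a_{j+1} = b_{i+1}, 1 otherwise (0-based: A[j], B[i]).
  dcost : (i j : ℕ) → i < m → j < n → ℕ
  dcost i j i<m j<n =
    if does (lookup A (fromℕ< j<n) ≟ᶠ lookup B (fromℕ< i<m)) then 0 else 1

  data Path : ℕ → ℕ → ℕ → Set where
    start : Path 0 0 0
    horiz : ∀ {i j c} → Path i j c → j < n → Path i (suc j) (c + hcost i j)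
    vert  : ∀ {i j c} → Path i j c → i < m → Path (suc i) j (c + vcost i j)
    diag  : ∀ {i j c} → Path i j c → (i<m : i < m) → (j<n : j < n) →
            Path (suc i) (suc j) (c + dcost i j i<m j<n)

  MinCost : ℕ → ℕ → ℕ → Set
  MinCost i j c = Path i j c × (∀ c' → Path i j c' → c ≤ c')

-- An indel moving toward the main diagonal costs 0, so any path to a cell
-- left of the main diagonal extends for free horizontally, as long as it stays
-- (weakly) left of the diagonal; likewise vertically on the right.  Hence the
-- cheapest path to the farther cell costs at most as much as one to the nearer.
module Submission where

open import Defs
open import Data.Nat using (ℕ; suc; _+_; _≤_; _<_; _≤′_; ≤′-refl; ≤′-step)
open import Data.Nat.Properties using (<⇒≤; <⇒<ᵇ; ≤⇒≤′; +-identityʳ; +-suc)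
open import Data.Fin using (Fin)
open import Data.Vec using (Vec)
open import Data.Bool using (true; T; if_then_else_)
open import Data.Product using (_×_; _,_)
open import Relation.Binary.PropositionalEquality using (_≡_; refl; cong; trans; subst)

if-then-T : ∀ {A : Set} b {x y : A} → T b → (if b then x else y) ≡ x
if-then-T true _ = refl

module _ {k n m : ℕ} (A : Vec (Fin k) n) (B : Vec (Fin k) m) where
  open EditGraph A B

  hcost-toward-diagonal : ∀ {i j} → j + m < n + i → hcost i j ≡ 0
  hcost-toward-diagonal lt = if-then-T _ (<⇒<ᵇ lt)

  vcost-toward-diagonal : ∀ {i j} → n + i < j + m → vcost i j ≡ 0
  vcost-toward-diagonal lt = if-then-T _ (<⇒<ᵇ lt)

  horiz-free : ∀ {i j c} → Path i j c → j < n → j + m < n + i → Path i (suc j) c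
  horiz-free {i} {j} {c} p j<n lt =
    subst (Path i (suc j)) (trans (cong (c +_) (hcost-toward-diagonal lt)) (+-identityʳ c))
      (horiz p j<n)

  vert-free : ∀ {i j c} → Path i j c → i < m → n + i < j + m → Path (suc i) j c
  vert-free {i} {j} {c} p i<m lt =
    subst (Path (suc i) j) (trans (cong (c +_) (vcost-toward-diagonal lt)) (+-identityʳ c))
      (vert p i<m)

  extend-along-row : ∀ {i j j' c} → Path i j c → j ≤′ j' → j' ≤ n → j' + m ≤ n + i →
                     Path i j' c
  extend-along-row p ≤′-refl _ _ = p
  extend-along-row p (≤′-step j≤j') j'<n lt =
    horiz-free (extend-along-row p j≤j' (<⇒≤ j'<n) (<⇒≤ lt)) j'<n lt

  extend-along-column : ∀ {i i' j c} → Path i j c → i ≤′ i' → i' ≤ m → n + i' ≤ j + m →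
                        Path i' j c
  extend-along-column p ≤′-refl _ _ = p
  extend-along-column {i' = suc i'} {j} p (≤′-step i≤i') i'<m le =
    vert-free (extend-along-column p i≤i' (<⇒≤ i'<m) (<⇒≤ lt)) i'<m lt
    where
      lt : n + i' < j + m
      lt = subst (_≤ j + m) (+-suc n i') le

  row-nonincreasing : ∀ {i j j' c c'} → j ≤ j' → j' ≤ n → j' + m ≤ n + i →
                      MinCost i j c → MinCost i j' c' → c' ≤ c
  row-nonincreasing j≤j' j'≤n left (p , _) (_ , minimal) =
    minimal _ (extend-along-row p (≤⇒≤′ j≤j') j'≤n left)

  column-nonincreasing : ∀ {i i' j c c'} → i ≤ i' → i' ≤ m → n + i' ≤ j + m →
                         MinCost i j c → MinCost i' j c' → c' ≤ c
  column-nonincreasing i≤i' i'≤m right (p , _) (_ , minimal) =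
    minimal _ (extend-along-column p (≤⇒≤′ i≤i') i'≤m right)

corollary1 : (k n m : ℕ) → m ≤ n → (A : Vec (Fin k) n) → (B : Vec (Fin k) m) →
    ((i j j' c c' : ℕ) → i ≤ m → j ≤ j' → j' ≤ n → j' + m ≤ n + i →
      EditGraph.MinCost A B i j c → EditGraph.MinCost A B i j' c' → c' ≤ c)
    ×
    ((j i i' c c' : ℕ) → j ≤ n → i ≤ i' → i' ≤ m → n + i' ≤ j + m →
      EditGraph.MinCost A B i j c → EditGraph.MinCost A B i' j c' → c' ≤ c)
corollary1 k n m _ A B =
  (λ i j j' c c' _ → row-nonincreasing A B) ,
  (λ j i i' c c' _ → column-nonincreasing A B)
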